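{- Let $k\geq 3$, let $G$ be a $k$-uniform path block graph with clique sequence $C_1,\dots,C_q$, let $u\in C_q$ be a vertex that is not a cut-vertex of $G$, and let $c,d$ be non-negative integers such that either $c>k-1\geq d$ or $c=d=k-1$. Let $\ell=\max\{c,2k-2\}$. Then there exists an $\ell$-orientation of $G$ compensated by $(c,d,u)$.
   Context: An orientation $D$ of a graph replaces each edge by exactly one of its two possible arcs; $d^-_D(v)$ is the indegree of $v$; an $\ell$-orientation has maximum indegree at most $\ell$. A block graph is a graph whose 2-connected components (blocks) are complete graphs; it is $k$-uniform if every block has exactly $k=\omega(G)$ vertices. A path block graph is a block graph whose block-cutpoint graph is a path; it consists of a sequence of cliques (blocks) $C_1,\dots,C_q$ where consecutive cliques $C_i,C_{i+1}$ share exactly one vertex and $C_i\cap C_{i+1}\neq C_{i+1}\cap C_{i+2}$ for all $i\in[q-2]$. For a graph $G$, $u\in V(G)$ and integers $c,d$, an orientation $D$ of $G$ is compensated by $(c,d,u)$ if $d^-_D(u)=d$ and the map $f$ with $f(v)=d^-_D(v)$ for $v\neq u$ and $f(u)=c$ is a proper coloring of $G$ (adjacent vertices get distinct values). -}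

module Defs where

open import Data.Nat using (ℕ; suc; _<_)
open import Data.Bool using (Bool; true; false; not)
open import Data.Fin using (Fin; toℕ)
open import Data.Fin.Subset using (Subset; _∈_; _∩_; ∣_∣; Empty)
open import Data.Vec using (tabulate)
open import Data.Product using (Σ; ∃; _×_)
open import Relation.Binary.PropositionalEquality using (_≡_; _≢_)
open import Relation.Nullary using (¬_; yes; no)

-- A k-uniform path block graph on vertex set Fin n, given by its clique
-- sequence C₁,…,C_q (indexed by Fin q with q = suc q′ ≥ 1, so C_q exists).
-- The graph is the union of the cliques (see Adj below).
record PathBlockGraph (k n : ℕ) : Set where
  field
    q′ : ℕ
    C : Fin (suc q′) → Subset n
    size : ∀ i → ∣ C i ∣ ≡ k
    cover : ∀ v → ∃ λ i → v ∈ C i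
    consec : ∀ i j → toℕ j ≡ suc (toℕ i) → ∣ C i ∩ C j ∣ ≡ 1
    -- non-consecutive cliques are disjoint (block-cutpoint graph is a path)
    nonconsec : ∀ i j → suc (toℕ i) < toℕ j → Empty (C i ∩ C j)
    distinct : ∀ i j l → toℕ j ≡ suc (toℕ i) → toℕ l ≡ suc (toℕ j) →
               C i ∩ C j ≢ C j ∩ C l

open PathBlockGraph public

lastClique : ∀ {k n} → PathBlockGraph k n → Subset n
lastClique G = C G (Data.Fin.fromℕ (q′ G))

Adj : ∀ {k n} → PathBlockGraph k n → Fin n → Fin n → Set
Adj G x y = x ≢ y × ∃ λ i → x ∈ C G i × y ∈ C G i

IsCutVertex : ∀ {k n} → PathBlockGraph k n → Fin n → Set
IsCutVertex G v = ∃ λ i → ∃ λ j → i ≢ j × v ∈ C G i × v ∈ C G j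

-- an orientation: arc x y ≡ true means the arc x → y is present
record Orientation {k n} (G : PathBlockGraph k n) : Set where
  field
    arc : Fin n → Fin n → Bool
    oneDir : ∀ x y → Adj G x y → arc x y ≡ not (arc y x)
    noArc : ∀ x y → ¬ Adj G x y → arc x y ≡ false

open Orientation public

indeg : ∀ {k n} {G : PathBlockGraph k n} → Orientation G → Fin n → ℕ
indeg D v = ∣ tabulate (λ x → arc D x v) ∣

IsLOrientation : ∀ {k n} {G : PathBlockGraph k n} → ℕ → Orientation G → Set
IsLOrientation ℓ D = ∀ v → indeg D v Data.Nat.≤ ℓ

ProperColoring : ∀ {k n} → PathBlockGraph k n → (Fin n → ℕ) → Set
ProperColoring G f = ∀ x y → Adj G x y → f x ≢ f y

compMap : ∀ {k n} {G : PathBlockGraph k n} → Orientation G → ℕ → Fin n → Fin n → ℕ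
compMap D c u v with v Data.Fin.≟ u
... | yes _ = c
... | no _ = indeg D v

CompensatedBy : ∀ {k n} {G : PathBlockGraph k n} → Orientation G → ℕ → ℕ → Fin n → Set
CompensatedBy {G = G} D c d u = indeg D u ≡ d × ProperColoring G (compMap D c u)

-- Orient every edge from lower to higher rank.  The joints C_i ∩ C_{i+1} (the cut vertices) are
-- ranked alternately at the bottom and at the top, the last one at the bottom exactly when d > 0,
-- and the private vertices in between.  A bottom joint then has indegree 0, a top joint 2k − 2
-- (only k in the extreme case d = 0, c = 2k − 2, where the private vertices of C_q are lifted above
-- it), and the private vertices of one block have distinct indegrees, increasing with the rank and at
-- most k − 1; so the indegrees properly colour G.  Finally u is slotted into the ranking just above
-- exactly d vertices of C_q − u, which gives d⁻(u) = d, and the hypothesis on (c, d) separates c from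
-- the indegrees of the other vertices of C_q.

module Submission where

open import Defs
open import Data.Bool using (Bool; true; false; not; if_then_else_)
open import Data.Bool.Properties using (not-involutive)
open import Data.Fin as Fin using (Fin; zero; suc; toℕ; fromℕ; fromℕ<)
open import Data.Fin.Properties using (any?; toℕ<n; toℕ-fromℕ; toℕ-fromℕ<; fromℕ<-toℕ; toℕ-injective)
open import Data.Fin.Subset
  using (Subset; inside; outside; _∈_; _∉_; _⊆_; _⊂_; _∩_; _∪_; _─_; _-_; ⁅_⁆; ⊥; ∣_∣; Empty; Nonempty)
open import Data.Fin.Subset.Properties
  using (_∈?_; nonempty?; ∉⊥; ∣⊥∣≡0; Empty-unique; x∈⁅x⁆; x∈⁅y⁆⇒x≡y; x∉⁅y⁆⇒x≢y; ∣⁅x⁆∣≡1; ⊆-antisym;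
         p⊆q⇒∣p∣≤∣q∣; p⊂q⇒∣p∣<∣q∣; p∩q⊆p; x∈p∩q⁺; x∈p∩q⁻; x∈p∪q⁺; x∈p∪q⁻; p─⊥≡p; p─q⊆p;
         x∈p∧x≢y⇒x∈p-y)
open import Data.Nat hiding (∣_-_∣)
open import Data.Nat.Properties
open import Data.Product using (∃; _×_; _,_; proj₁; proj₂)
open import Data.Sum using (_⊎_; inj₁; inj₂; [_,_]′)
open import Data.Vec using ([]; _∷_; tabulate; here; there)
open import Data.Vec.Properties using (lookup∘tabulate; []=⇒lookup; lookup⇒[]=)
open import Function using (_∘_)
open import Function.Definitions using (Injective)
open import Relation.Binary.PropositionalEquality
open import Relation.Nullary
open import Relation.Nullary.Decidable using (dec-true; dec-false; map′)
open import Relation.Unary using (Pred; Decidable)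
open import Relation.Binary using (tri<; tri≈; tri>)

-- Counting in finite subsets

∣p∪q∣+∣p∩q∣≡∣p∣+∣q∣ : ∀ {n} (p q : Subset n) → ∣ p ∪ q ∣ + ∣ p ∩ q ∣ ≡ ∣ p ∣ + ∣ q ∣
∣p∪q∣+∣p∩q∣≡∣p∣+∣q∣ []            []            = refl
∣p∪q∣+∣p∩q∣≡∣p∣+∣q∣ (outside ∷ p) (outside ∷ q) = ∣p∪q∣+∣p∩q∣≡∣p∣+∣q∣ p q
∣p∪q∣+∣p∩q∣≡∣p∣+∣q∣ (inside  ∷ p) (outside ∷ q) = cong suc (∣p∪q∣+∣p∩q∣≡∣p∣+∣q∣ p q)
∣p∪q∣+∣p∩q∣≡∣p∣+∣q∣ (outside ∷ p) (inside  ∷ q) =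
  trans (cong suc (∣p∪q∣+∣p∩q∣≡∣p∣+∣q∣ p q)) (sym (+-suc ∣ p ∣ ∣ q ∣))
∣p∪q∣+∣p∩q∣≡∣p∣+∣q∣ (inside  ∷ p) (inside  ∷ q) = cong suc (begin
  ∣ p ∪ q ∣ + suc ∣ p ∩ q ∣  ≡⟨ +-suc ∣ p ∪ q ∣ ∣ p ∩ q ∣ ⟩
  suc (∣ p ∪ q ∣ + ∣ p ∩ q ∣) ≡⟨ cong suc (∣p∪q∣+∣p∩q∣≡∣p∣+∣q∣ p q) ⟩
  suc (∣ p ∣ + ∣ q ∣)         ≡⟨ +-suc ∣ p ∣ ∣ q ∣ ⟨
  ∣ p ∣ + suc ∣ q ∣           ∎)
  where open ≡-Reasoning

∣p∪q∣≤∣p∣+∣q∣ : ∀ {n} (p q : Subset n) → ∣ p ∪ q ∣ ≤ ∣ p ∣ + ∣ q ∣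
∣p∪q∣≤∣p∣+∣q∣ p q = ≤-trans (m≤m+n ∣ p ∪ q ∣ ∣ p ∩ q ∣) (≤-reflexive (∣p∪q∣+∣p∩q∣≡∣p∣+∣q∣ p q))

Empty⇒∣p∣≡0 : ∀ {n} {p : Subset n} → Empty p → ∣ p ∣ ≡ 0
Empty⇒∣p∣≡0 {n} p-empty = trans (cong ∣_∣ (Empty-unique p-empty)) (∣⊥∣≡0 n)

Empty[p∩q]⇒∣p∪q∣≡∣p∣+∣q∣ : ∀ {n} (p q : Subset n) → Empty (p ∩ q) → ∣ p ∪ q ∣ ≡ ∣ p ∣ + ∣ q ∣
Empty[p∩q]⇒∣p∪q∣≡∣p∣+∣q∣ p q disjoint = begin
  ∣ p ∪ q ∣             ≡⟨ +-identityʳ ∣ p ∪ q ∣ ⟨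
  ∣ p ∪ q ∣ + 0         ≡⟨ cong (∣ p ∪ q ∣ +_) (Empty⇒∣p∣≡0 disjoint) ⟨
  ∣ p ∪ q ∣ + ∣ p ∩ q ∣ ≡⟨ ∣p∪q∣+∣p∩q∣≡∣p∣+∣q∣ p q ⟩
  ∣ p ∣ + ∣ q ∣         ∎
  where open ≡-Reasoning

x∈p⇒suc∣p-x∣≡∣p∣ : ∀ {n} {x : Fin n} {p : Subset n} → x ∈ p → suc ∣ p - x ∣ ≡ ∣ p ∣
x∈p⇒suc∣p-x∣≡∣p∣ {x = zero}  {inside  ∷ p} here        = cong (λ q → suc ∣ q ∣) (p─⊥≡p p)
x∈p⇒suc∣p-x∣≡∣p∣ {x = suc x} {inside  ∷ p} (there x∈p) = cong suc (x∈p⇒suc∣p-x∣≡∣p∣ x∈p)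
x∈p⇒suc∣p-x∣≡∣p∣ {x = suc x} {outside ∷ p} (there x∈p) = x∈p⇒suc∣p-x∣≡∣p∣ x∈p

x∈p─q⇒x∉q : ∀ {n} {x : Fin n} (p q : Subset n) → x ∈ p ─ q → x ∉ q
x∈p─q⇒x∉q (_ ∷ p) (outside ∷ q) (there x∈p─q) (there x∈q) = x∈p─q⇒x∉q p q x∈p─q x∈q
x∈p─q⇒x∉q (_ ∷ p) (inside  ∷ q) (there x∈p─q) (there x∈q) = x∈p─q⇒x∉q p q x∈p─q x∈q

x∈p-y⁻ : ∀ {n} {x y : Fin n} {p : Subset n} → x ∈ p - y → x ∈ p × x ≢ y
x∈p-y⁻ {p = p} x∈p-y = p─q⊆p p _ x∈p-y , x∉⁅y⁆⇒x≢y (x∈p─q⇒x∉q p _ x∈p-y)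

⁅x⁆⊆p : ∀ {n} {x : Fin n} {p : Subset n} → x ∈ p → ⁅ x ⁆ ⊆ p
⁅x⁆⊆p {p = p} x∈p y∈⁅x⁆ = subst (_∈ p) (sym (x∈⁅y⁆⇒x≡y _ y∈⁅x⁆)) x∈p

x∈p⇒0<∣p∣ : ∀ {n} {x : Fin n} {p : Subset n} → x ∈ p → 0 < ∣ p ∣
x∈p⇒0<∣p∣ {x = x} {p} x∈p = subst (_≤ ∣ p ∣) (∣⁅x⁆∣≡1 x) (p⊆q⇒∣p∣≤∣q∣ (⁅x⁆⊆p x∈p))

0<∣p∣⇒Nonempty : ∀ {n} {p : Subset n} → 0 < ∣ p ∣ → Nonempty p
0<∣p∣⇒Nonempty {p = p} 0<∣p∣ with nonempty? p
... | yes p-nonempty = p-nonempty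
... | no  p-empty    = contradiction (Empty⇒∣p∣≡0 p-empty) (>⇒≢ 0<∣p∣)

∣p∣≤1⇒x≡y : ∀ {n} {x y : Fin n} {p : Subset n} → ∣ p ∣ ≤ 1 → x ∈ p → y ∈ p → x ≡ y
∣p∣≤1⇒x≡y {x = x} {y} {p} ∣p∣≤1 x∈p y∈p with x Fin.≟ y
... | yes x≡y = x≡y
... | no  x≢y = contradiction ∣p∣≤1 (<⇒≱ (subst (_< ∣ p ∣) (∣⁅x⁆∣≡1 x) (p⊂q⇒∣p∣<∣q∣ ⁅x⁆⊂p)))
  where ⁅x⁆⊂p = (λ {z} → ⁅x⁆⊆p x∈p {z}) , y , y∈p , λ y∈⁅x⁆ → x≢y (sym (x∈⁅y⁆⇒x≡y x y∈⁅x⁆))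

module _ {n ℓ} {P : Pred (Fin n) ℓ} (P? : Decidable P) where

  subsetOf : Subset n
  subsetOf = tabulate (λ x → does (P? x))

  ∈-subsetOf⁺ : ∀ {x} → P x → x ∈ subsetOf
  ∈-subsetOf⁺ {x} px = lookup⇒[]= x subsetOf (trans (lookup∘tabulate _ x) (dec-true (P? x) px))

  ∈-subsetOf⁻ : ∀ {x} → x ∈ subsetOf → P x
  ∈-subsetOf⁻ {x} x∈ with P? x | trans (sym (lookup∘tabulate (λ y → does (P? y)) x)) ([]=⇒lookup x∈)
  ... | yes px | _ = px

-- Injective keys and thresholds

intermediate-value : (g : ℕ → ℕ) → g 0 ≡ 0 → (∀ m → g (suc m) ≤ suc (g m)) →
                     ∀ {d} M → d ≤ g M → ∃ λ m → g m ≡ d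
intermediate-value g g0≡0 step zero    d≤g0 = 0 , trans g0≡0 (sym (n≤0⇒n≡0 (subst (_ ≤_) g0≡0 d≤g0)))
intermediate-value g g0≡0 step {d} (suc M) d≤gM+1 with d ≤? g M
... | yes d≤gM = intermediate-value g g0≡0 step M d≤gM
... | no  d≰gM = suc M , ≤-antisym (≤-trans (step M) (≰⇒> d≰gM)) d≤gM+1

module Threshold {n : ℕ} (key : Fin n → ℕ) (key-injective : Injective _≡_ _≡_ key) where

  below : ℕ → Subset n
  below m = subsetOf (λ x → key x <? m)

  ∈below⁺ : ∀ {x m} → key x < m → x ∈ below m
  ∈below⁺ {m = m} = ∈-subsetOf⁺ (λ x → key x <? m)

  ∈below⁻ : ∀ {x m} → x ∈ below m → key x < m
  ∈below⁻ {m = m} = ∈-subsetOf⁻ (λ x → key x <? m)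

  ∣S∩below[1+m]∣≤1+∣S∩below[m]∣ : ∀ S m → ∣ S ∩ below (suc m) ∣ ≤ suc ∣ S ∩ below m ∣
  ∣S∩below[1+m]∣≤1+∣S∩below[m]∣ S m with any? (λ x → key x ≟ m)
  ... | yes (x , key[x]≡m) = begin
      ∣ S ∩ below (suc m) ∣           ≤⟨ p⊆q⇒∣p∣≤∣q∣ ⊆∪⁅x⁆ ⟩
      ∣ (S ∩ below m) ∪ ⁅ x ⁆ ∣       ≤⟨ ∣p∪q∣≤∣p∣+∣q∣ (S ∩ below m) ⁅ x ⁆ ⟩
      ∣ S ∩ below m ∣ + ∣ ⁅ x ⁆ ∣     ≡⟨ cong (∣ S ∩ below m ∣ +_) (∣⁅x⁆∣≡1 x) ⟩
      ∣ S ∩ below m ∣ + 1             ≡⟨ +-comm ∣ S ∩ below m ∣ 1 ⟩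
      suc ∣ S ∩ below m ∣             ∎
    where
    open ≤-Reasoning
    ⊆∪⁅x⁆ : S ∩ below (suc m) ⊆ (S ∩ below m) ∪ ⁅ x ⁆
    ⊆∪⁅x⁆ {z} z∈ with x∈p∩q⁻ S (below (suc m)) z∈ | key z <? m
    ... | z∈S , _            | yes key[z]<m = x∈p∪q⁺ (inj₁ (x∈p∩q⁺ (z∈S , ∈below⁺ key[z]<m)))
    ... | _   , z∈below[1+m] | no  key[z]≮m = x∈p∪q⁺ (inj₂ (subst (_∈ ⁅ x ⁆) (sym z≡x) (x∈⁅x⁆ x)))
      where z≡x = key-injective (trans (≤-antisym (≤-pred (∈below⁻ z∈below[1+m])) (≮⇒≥ key[z]≮m)) (sym key[x]≡m))
  ... | no  ∄x = ≤-trans (p⊆q⇒∣p∣≤∣q∣ ⊆S∩below[m]) (n≤1+n _)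
    where
    ⊆S∩below[m] : S ∩ below (suc m) ⊆ S ∩ below m
    ⊆S∩below[m] {z} z∈ with x∈p∩q⁻ S (below (suc m)) z∈
    ... | z∈S , z∈below[1+m] = x∈p∩q⁺ (z∈S , ∈below⁺ key[z]<m)
      where key[z]<m = ≤∧≢⇒< (≤-pred (∈below⁻ z∈below[1+m])) λ key[z]≡m → ∄x (z , key[z]≡m)

  threshold : ∀ {M d} (S : Subset n) → (∀ x → key x < M) → d ≤ ∣ S ∣ →
              ∃ λ m → ∣ S ∩ below m ∣ ≡ d
  threshold {M} S key<M d≤∣S∣ =
    intermediate-value (λ m → ∣ S ∩ below m ∣) ∣S∩below[0]∣≡0 (∣S∩below[1+m]∣≤1+∣S∩below[m]∣ S) M
      (subst (_ ≤_) (sym ∣S∩below[M]∣≡∣S∣) d≤∣S∣)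
    where
    ∣S∩below[0]∣≡0 : ∣ S ∩ below 0 ∣ ≡ 0
    ∣S∩below[0]∣≡0 = Empty⇒∣p∣≡0 λ (x , x∈) → n≮0 (∈below⁻ (proj₂ (x∈p∩q⁻ S (below 0) x∈)))
    ∣S∩below[M]∣≡∣S∣ : ∣ S ∩ below M ∣ ≡ ∣ S ∣
    ∣S∩below[M]∣≡∣S∣ = cong ∣_∣ (⊆-antisym (p∩q⊆p S (below M)) λ x∈S → x∈p∩q⁺ (x∈S , ∈below⁺ (key<M _)))

*+-<-lex : ∀ {a b r} n s → a < b → r < n → a * n + r < b * n + s
*+-<-lex {a} {b} {r} n s a<b r<n = begin-strict
  a * n + r  <⟨ +-monoʳ-< (a * n) r<n ⟩
  a * n + n  ≡⟨ +-comm (a * n) n ⟩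
  suc a * n  ≤⟨ *-monoˡ-≤ n a<b ⟩
  b * n      ≤⟨ m≤m+n (b * n) s ⟩
  b * n + s  ∎
  where open ≤-Reasoning

module LexKey {n : ℕ} (level : Fin n → ℕ) where

  -- Like rank, orientation and level below, key is opaque: unfolding these rankings inside the
  -- indegree arguments makes type checking very slow.
  opaque
    key : Fin n → ℕ
    key x = level x * n + toℕ x

    key-mono : ∀ {x y} → level x < level y → key x < key y
    key-mono {x} {y} lx<ly = *+-<-lex n (toℕ y) lx<ly (toℕ<n x)

    key-injective : Injective _≡_ _≡_ key
    key-injective {x} {y} kx≡ky with <-cmp (level x) (level y)
    ... | tri< lx<ly _ _ = contradiction kx≡ky (<⇒≢ (key-mono lx<ly))
    ... | tri> _ _ ly<lx = contradiction kx≡ky (>⇒≢ (key-mono ly<lx))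
    ... | tri≈ _ lx≡ly _ = toℕ-injective (+-cancelˡ-≡ (level y * n) (toℕ x) (toℕ y)
                             (subst (λ l → l * n + toℕ x ≡ key y) lx≡ly kx≡ky))

    key-bound : ∀ {L} → (∀ x → level x < L) → ∀ x → key x < L * n
    key-bound {L} level<L x = subst (key x <_) (+-identityʳ (L * n)) (*+-<-lex n 0 (level<L x) (toℕ<n x))

module InsertAt {n : ℕ} (key : Fin n → ℕ) (key-injective : Injective _≡_ _≡_ key) (u : Fin n) (m : ℕ) where

  opaque
    rank : Fin n → ℕ
    rank x with x Fin.≟ u
    ... | yes _ = 2 * m
    ... | no  _ = suc (2 * key x)

    rank-u : rank u ≡ 2 * m
    rank-u with u Fin.≟ u
    ... | yes _   = refl
    ... | no  u≢u = contradiction refl u≢u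

    rank-≢u : ∀ {x} → x ≢ u → rank x ≡ suc (2 * key x)
    rank-≢u {x} x≢u with x Fin.≟ u
    ... | yes x≡u = contradiction x≡u x≢u
    ... | no  _   = refl

    rank-injective : Injective _≡_ _≡_ rank
    rank-injective {x} {y} rx≡ry with x Fin.≟ u | y Fin.≟ u
    ... | yes x≡u | yes y≡u = trans x≡u (sym y≡u)
    ... | yes _   | no  _   = contradiction rx≡ry (even≢odd m (key y))
    ... | no  _   | yes _   = contradiction (sym rx≡ry) (even≢odd m (key x))
    ... | no  _   | no  _   = key-injective (*-cancelˡ-≡ (key x) (key y) 2 (suc-injective rx≡ry))

  rank-mono : ∀ {x y} → x ≢ u → y ≢ u → key x < key y → rank x < rank y
  rank-mono x≢u y≢u kx<ky = subst₂ _<_ (sym (rank-≢u x≢u)) (sym (rank-≢u y≢u)) (s≤s (*-monoʳ-< 2 kx<ky))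

  rank<rank-u : ∀ {x} → x ≢ u → key x < m → rank x < rank u
  rank<rank-u {x} x≢u kx<m = subst₂ _<_ (sym (rank-≢u x≢u)) (sym rank-u)
    (≤-trans (≤-reflexive (sym (*-suc 2 (key x)))) (*-monoʳ-≤ 2 kx<m))

  rank-u<rank : ∀ {x} → x ≢ u → m ≤ key x → rank u < rank x
  rank-u<rank x≢u m≤kx = subst₂ _<_ (sym rank-u) (sym (rank-≢u x≢u)) (s≤s (*-monoʳ-≤ 2 m≤kx))

  rank<rank-u⁻ : ∀ {x} → x ≢ u → rank x < rank u → key x < m
  rank<rank-u⁻ x≢u rx<ru = ≰⇒> λ m≤kx → <-asym rx<ru (rank-u<rank x≢u m≤kx)

-- Blocks of a path block graph

module PathBlocks {k n : ℕ} (G : PathBlockGraph k n) where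

  -- The blocks C_0, …, C_{q′} indexed by ℕ, so that the successor block is block (suc i);
  -- beyond the last index block i is empty.
  block : ℕ → Subset n
  block i with i <? suc (q′ G)
  ... | yes i<q = C G (fromℕ< i<q)
  ... | no  _   = ⊥

  -- A record rather than x ∈ block i, so that the index i can be inferred from a membership proof.
  record _∈ᵇ_ (x : Fin n) (i : ℕ) : Set where
    constructor inBlock
    field ∈block : x ∈ block i

  open _∈ᵇ_ public

  Adj-sym : ∀ {x y} → Adj G x y → Adj G y x
  Adj-sym (x≢y , i , x∈ , y∈) = ≢-sym x≢y , i , y∈ , x∈

  adj? : ∀ x y → Dec (Adj G x y)
  adj? x y = ¬? (x Fin.≟ y) ×-dec any? (λ i → (x ∈? C G i) ×-dec (y ∈? C G i))

  block-toℕ : ∀ i → block (toℕ i) ≡ C G i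
  block-toℕ i with toℕ i <? suc (q′ G)
  ... | yes i<q = cong (C G) (fromℕ<-toℕ i i<q)
  ... | no  i≮q = contradiction (toℕ<n i) i≮q

  block-fromℕ< : ∀ {i} (i<q : i < suc (q′ G)) → block i ≡ C G (fromℕ< i<q)
  block-fromℕ< i<q = trans (cong block (sym (toℕ-fromℕ< i<q))) (block-toℕ (fromℕ< i<q))

  ∈ᵇ⇒< : ∀ {x i} → x ∈ᵇ i → i < suc (q′ G)
  ∈ᵇ⇒< {i = i} (inBlock x∈) with i <? suc (q′ G)
  ... | yes i<q = i<q
  ... | no  _   = contradiction x∈ ∉⊥

  ∈ᵇ⇒∈C : ∀ {x i} (x∈ : x ∈ᵇ i) → x ∈ C G (fromℕ< (∈ᵇ⇒< x∈))
  ∈ᵇ⇒∈C x∈ = subst (_ ∈_) (block-fromℕ< (∈ᵇ⇒< x∈)) (∈block x∈)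

  ∈C⇒∈ᵇ : ∀ {x i} → x ∈ C G i → x ∈ᵇ toℕ i
  ∈C⇒∈ᵇ {i = i} x∈ = inBlock (subst (_ ∈_) (sym (block-toℕ i)) x∈)

  _∈ᵇ?_ : ∀ x i → Dec (x ∈ᵇ i)
  x ∈ᵇ? i = map′ inBlock ∈block (x ∈? block i)

  ∣block-x∣ : ∀ {x i} → x ∈ᵇ i → ∣ block i - x ∣ ≡ k ∸ 1
  ∣block-x∣ x∈ = cong (_∸ 1) (trans (x∈p⇒suc∣p-x∣≡∣p∣ (∈block x∈)) ∣block∣)
    where ∣block∣ = trans (cong ∣_∣ (block-fromℕ< (∈ᵇ⇒< x∈))) (size G _)

  block-separated : ∀ {x i j} → suc i < j → x ∈ᵇ i → ¬ x ∈ᵇ j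
  block-separated {x} 1+i<j x∈i x∈j =
    nonconsec G _ _ 1+i<j′ (x , x∈p∩q⁺ (∈ᵇ⇒∈C x∈i , ∈ᵇ⇒∈C x∈j))
    where 1+i<j′ = subst₂ (λ a b → suc a < b) (sym (toℕ-fromℕ< (∈ᵇ⇒< x∈i))) (sym (toℕ-fromℕ< (∈ᵇ⇒< x∈j))) 1+i<j

  block-cover : ∀ x → ∃ (x ∈ᵇ_)
  block-cover x with cover G x
  ... | i , x∈ = toℕ i , ∈C⇒∈ᵇ x∈

  ∈lastClique⇒∈ᵇ : ∀ {x} → x ∈ lastClique G → x ∈ᵇ q′ G
  ∈lastClique⇒∈ᵇ x∈ = subst (_ ∈ᵇ_) (toℕ-fromℕ (q′ G)) (∈C⇒∈ᵇ x∈)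

  Adj⇒block : ∀ {x y} → Adj G x y → ∃ λ i → x ∈ᵇ i × y ∈ᵇ i
  Adj⇒block (_ , i , x∈ , y∈) = toℕ i , ∈C⇒∈ᵇ x∈ , ∈C⇒∈ᵇ y∈

  block⇒Adj : ∀ {x y i} → x ≢ y → x ∈ᵇ i → y ∈ᵇ i → Adj G x y
  block⇒Adj x≢y x∈ y∈ = x≢y , _ , ∈ᵇ⇒∈C x∈ , subst (_ ∈_) (block-fromℕ< (∈ᵇ⇒< x∈)) (∈block y∈)

  blocks-consecutive : ∀ {x i j} → x ∈ᵇ i → x ∈ᵇ j → i < j → j ≡ suc i
  blocks-consecutive {i = i} {j} x∈i x∈j i<j with suc i ≟ j
  ... | yes 1+i≡j = sym 1+i≡j
  ... | no  1+i≢j = contradiction x∈j (block-separated (≤∧≢⇒< i<j 1+i≢j) x∈i)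

  Joint : Fin n → ℕ → Set
  Joint x i = x ∈ᵇ i × x ∈ᵇ suc i

  Private : Fin n → Set
  Private x = ∀ {i} → ¬ Joint x i

  joint? : ∀ x → Dec (∃ (Joint x))
  joint? x = map′ (λ (i , _ , J) → i , J) (λ (i , J) → i , ≤-pred (∈ᵇ⇒< (proj₂ J)) , J)
    (anyUpTo? (λ i → (x ∈ᵇ? i) ×-dec (x ∈ᵇ? suc i)) (q′ G))

  joint-or-private : ∀ x → ∃ (Joint x) ⊎ Private x
  joint-or-private x with joint? x
  ... | yes J  = inj₁ J
  ... | no  ¬J = inj₂ λ Jx → ¬J (_ , Jx)

  joint-blocks : ∀ {x i j} → Joint x i → x ∈ᵇ j → j ≡ i ⊎ j ≡ suc i
  joint-blocks {i = i} {j} (x∈i , x∈1+i) x∈j with <-cmp j i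
  ... | tri< j<i _ _ = contradiction x∈1+i (block-separated (s≤s j<i) x∈j)
  ... | tri≈ _ j≡i _ = inj₁ j≡i
  ... | tri> _ _ i<j = inj₂ (blocks-consecutive x∈i x∈j i<j)

  joint-index-unique : ∀ {x i j} → Joint x i → Joint x j → i ≡ j
  joint-index-unique {i = i} {j} (x∈i , x∈1+i) (x∈j , x∈1+j) with <-cmp i j
  ... | tri< i<j _ _ = contradiction x∈1+j (block-separated (s≤s i<j) x∈i)
  ... | tri≈ _ i≡j _ = i≡j
  ... | tri> _ _ j<i = contradiction x∈1+i (block-separated (s≤s j<i) x∈j)

  joint-unique : ∀ {x y i} → Joint x i → Joint y i → x ≡ y
  joint-unique {i = i} (x∈i , x∈1+i) (y∈i , y∈1+i) =
    ∣p∣≤1⇒x≡y (≤-reflexive ∣block∩block[1+i]∣) (x∈p∩q⁺ (∈ᵇ⇒∈C x∈i , ∈ᵇ⇒∈C x∈1+i)) (x∈p∩q⁺ (∈ᵇ⇒∈C y∈i , ∈ᵇ⇒∈C y∈1+i))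
    where
    ∣block∩block[1+i]∣ = consec G _ _ (trans (toℕ-fromℕ< (∈ᵇ⇒< x∈1+i)) (cong suc (sym (toℕ-fromℕ< (∈ᵇ⇒< x∈i)))))

  joint-last : ∀ {x i} → Joint x i → x ∈ᵇ q′ G → suc i ≡ q′ G
  joint-last J@(_ , x∈1+i) x∈last with joint-blocks J x∈last
  ... | inj₁ q≡i   = contradiction (≤-pred (∈ᵇ⇒< x∈1+i)) (<-irrefl (sym q≡i))
  ... | inj₂ q≡1+i = sym q≡1+i

  last-joint-unique : ∀ {x y i j} → Joint x i → Joint y j → x ∈ᵇ q′ G → y ∈ᵇ q′ G → x ≡ y
  last-joint-unique Jx Jy x∈last y∈last =
    joint-unique Jx (subst (Joint _) (suc-injective (trans (joint-last Jy y∈last) (sym (joint-last Jx x∈last)))) Jy)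

  joints-adjacent : ∀ {x y i j} → Joint x i → Joint y j → Adj G x y → j ≡ suc i ⊎ i ≡ suc j
  joints-adjacent Jx Jy adj with Adj⇒block adj
  ... | l , x∈l , y∈l with joint-blocks Jx x∈l | joint-blocks Jy y∈l
  ... | inj₁ refl | inj₂ refl = inj₂ refl
  ... | inj₂ refl | inj₁ refl = inj₁ refl
  ... | inj₁ refl | inj₁ refl = contradiction (joint-unique Jx Jy) (proj₁ adj)
  ... | inj₂ l≡1+i | inj₂ l≡1+j with suc-injective (trans (sym l≡1+i) l≡1+j)
  ...   | refl = contradiction (joint-unique Jx Jy) (proj₁ adj)

  private-block-unique : ∀ {x i j} → Private x → x ∈ᵇ i → x ∈ᵇ j → i ≡ j
  private-block-unique {x} {i} {j} px x∈i x∈j with <-cmp i j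
  ... | tri< i<j _ _ = contradiction (x∈i , subst (x ∈ᵇ_) (blocks-consecutive x∈i x∈j i<j) x∈j) px
  ... | tri≈ _ i≡j _ = i≡j
  ... | tri> _ _ j<i = contradiction (x∈j , subst (x ∈ᵇ_) (blocks-consecutive x∈j x∈i j<i) x∈i) px

  private-neighbour : ∀ {x y i} → Private x → x ∈ᵇ i → Adj G y x → y ∈ᵇ i
  private-neighbour {y = y} px x∈i adj with Adj⇒block adj
  ... | _ , y∈l , x∈l = subst (y ∈ᵇ_) (private-block-unique px x∈l x∈i) y∈l

  joint-neighbour : ∀ {x y i} → Joint x i → Adj G y x → y ∈ᵇ i ⊎ y ∈ᵇ suc i
  joint-neighbour J adj with Adj⇒block adj
  ... | _ , y∈l , x∈l with joint-blocks J x∈l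
  ... | inj₁ refl = inj₁ y∈l
  ... | inj₂ refl = inj₂ y∈l

  nonCut⇒Private : ∀ {x} → ¬ IsCutVertex G x → Private x
  nonCut⇒Private ¬cut (x∈i , x∈1+i) = ¬cut (_ , _ , i≢1+i , ∈ᵇ⇒∈C x∈i , ∈ᵇ⇒∈C x∈1+i)
    where
    i≢1+i = λ eq → 1+n≢n (sym (trans (sym (toℕ-fromℕ< (∈ᵇ⇒< x∈i))) (trans (cong toℕ eq) (toℕ-fromℕ< (∈ᵇ⇒< x∈1+i)))))

-- Orientations induced by a ranking

module RankOrientation {k n : ℕ} (G : PathBlockGraph k n)
                       (rank : Fin n → ℕ) (rank-injective : Injective _≡_ _≡_ rank) where

  open PathBlocks G using (Adj-sym; adj?)

  arc? : ∀ x y → Dec (Adj G x y × rank x < rank y)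
  arc? x y = adj? x y ×-dec (rank x <? rank y)

  inNeighbours : Fin n → Subset n
  inNeighbours v = subsetOf (λ x → arc? x v)

  opaque
    orientation : Orientation G
    orientation = record { arc = λ x y → does (arc? x y) ; oneDir = oneDir′ ; noArc = noArc′ }
      where
      oneDir′ : ∀ x y → Adj G x y → does (arc? x y) ≡ not (does (arc? y x))
      oneDir′ x y adj with <-cmp (rank x) (rank y)
      ... | tri< rx<ry _ _ = trans (dec-true (arc? x y) (adj , rx<ry))
                                   (cong not (sym (dec-false (arc? y x) λ (_ , ry<rx) → <-asym rx<ry ry<rx)))
      ... | tri≈ _ rx≡ry _ = contradiction (rank-injective rx≡ry) (proj₁ adj)
      ... | tri> _ _ ry<rx = trans (dec-false (arc? x y) λ (_ , rx<ry) → <-asym rx<ry ry<rx)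
                                   (cong not (sym (dec-true (arc? y x) (Adj-sym adj , ry<rx))))
      noArc′ : ∀ x y → ¬ Adj G x y → does (arc? x y) ≡ false
      noArc′ x y ¬adj = dec-false (arc? x y) (¬adj ∘ proj₁)

    indeg≡∣inNeighbours∣ : ∀ v → indeg orientation v ≡ ∣ inNeighbours v ∣
    indeg≡∣inNeighbours∣ v = refl

  ∈inNeighbours⁺ : ∀ {x v} → Adj G x v → rank x < rank v → x ∈ inNeighbours v
  ∈inNeighbours⁺ {v = v} adj rx<rv = ∈-subsetOf⁺ (λ x → arc? x v) (adj , rx<rv)

  ∈inNeighbours⁻ : ∀ {x v} → x ∈ inNeighbours v → Adj G x v × rank x < rank v
  ∈inNeighbours⁻ {v = v} = ∈-subsetOf⁻ (λ x → arc? x v)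

  indeg≡∣S∣ : ∀ {v} (S : Subset n) → S ⊆ inNeighbours v → inNeighbours v ⊆ S → indeg orientation v ≡ ∣ S ∣
  indeg≡∣S∣ {v} S S⊆ ⊆S = trans (indeg≡∣inNeighbours∣ v) (cong ∣_∣ (⊆-antisym ⊆S S⊆))

  indeg≤∣S∣ : ∀ {v} (S : Subset n) → inNeighbours v ⊆ S → indeg orientation v ≤ ∣ S ∣
  indeg≤∣S∣ {v} S ⊆S = subst (_≤ ∣ S ∣) (sym (indeg≡∣inNeighbours∣ v)) (p⊆q⇒∣p∣≤∣q∣ ⊆S)

  indeg<∣S∣ : ∀ {v} (S : Subset n) → inNeighbours v ⊂ S → indeg orientation v < ∣ S ∣
  indeg<∣S∣ {v} S ⊂S = subst (_< ∣ S ∣) (sym (indeg≡∣inNeighbours∣ v)) (p⊂q⇒∣p∣<∣q∣ ⊂S)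

  indeg-source : ∀ {v} → (∀ {y} → Adj G y v → rank v < rank y) → indeg orientation v ≡ 0
  indeg-source {v} v-below = trans (indeg≡∣inNeighbours∣ v) (Empty⇒∣p∣≡0 λ (y , y∈) →
    let (adj , ry<rv) = ∈inNeighbours⁻ y∈ in <-asym ry<rv (v-below adj))

  0<indeg : ∀ {x v} → Adj G x v → rank x < rank v → 0 < indeg orientation v
  0<indeg {v = v} adj rx<rv = subst (0 <_) (sym (indeg≡∣inNeighbours∣ v)) (x∈p⇒0<∣p∣ (∈inNeighbours⁺ adj rx<rv))

  indeg-mono : ∀ {x y} → Adj G x y → rank x < rank y → (∀ {z} → Adj G z x → z ≢ y → Adj G z y) →
               indeg orientation x < indeg orientation y
  indeg-mono {x} {y} adj rx<ry N[x]⊆N[y] =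
    subst (indeg orientation x <_) (sym (indeg≡∣inNeighbours∣ y))
      (indeg<∣S∣ (inNeighbours y) (In[x]⊆In[y] , x , ∈inNeighbours⁺ adj rx<ry , x∉In[x]))
    where
    x∉In[x] : x ∉ inNeighbours x
    x∉In[x] x∈ = proj₁ (proj₁ (∈inNeighbours⁻ x∈)) refl
    In[x]⊆In[y] : inNeighbours x ⊆ inNeighbours y
    In[x]⊆In[y] z∈ with ∈inNeighbours⁻ z∈
    ... | adj-zx , rz<rx = ∈inNeighbours⁺ (N[x]⊆N[y] adj-zx λ { refl → <-asym rz<rx rx<ry }) (<-trans rz<rx rx<ry)

alternate : Bool → ℕ → Bool
alternate b zero    = b
alternate b (suc j) = not (alternate b j)

a≡not[b]⇒b≡not[a] : ∀ {a b} → a ≡ not b → b ≡ not a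
a≡not[b]⇒b≡not[a] {b = b} a≡¬b = sym (trans (cong not a≡¬b) (not-involutive b))

m∸n≡suc[m∸[1+n]] : ∀ {m n} → n < m → m ∸ n ≡ suc (m ∸ suc n)
m∸n≡suc[m∸[1+n]] {suc m} {zero}  _         = refl
m∸n≡suc[m∸[1+n]] {suc m} {suc n} (s≤s n<m) = m∸n≡suc[m∸[1+n]] n<m

0<ᵇ⇒0< : ∀ {d} → (0 <ᵇ d) ≡ true → 0 < d
0<ᵇ⇒0< {zero}  ()
0<ᵇ⇒0< {suc _} _ = z<s

¬0<ᵇ⇒≡0 : ∀ {d} → (0 <ᵇ d) ≡ false → d ≡ 0
¬0<ᵇ⇒≡0 {zero}  _  = refl
¬0<ᵇ⇒≡0 {suc _} ()

if-< : ∀ b {x y z} → x < z → y < z → (if b then x else y) < z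
if-< true  x<z _   = x<z
if-< false _   y<z = y<z

suc[k∸1]≡k : ∀ {k} → 1 ≤ k → suc (k ∸ 1) ≡ k
suc[k∸1]≡k (s≤s _) = refl

2*k∸2≡[k∸1]+[k∸1] : ∀ k → 2 * k ∸ 2 ≡ (k ∸ 1) + (k ∸ 1)
2*k∸2≡[k∸1]+[k∸1] zero    = refl
2*k∸2≡[k∸1]+[k∸1] (suc k) = trans (cong (_∸ 1) (+-suc k (k + 0))) (cong (k +_) (+-identityʳ k))

k<2*k∸2 : ∀ {k} → 3 ≤ k → k < 2 * k ∸ 2
k<2*k∸2 {suc (suc (suc j))} (s≤s (s≤s (s≤s _))) =
  subst (3 + j <_) (sym (2*k∸2≡[k∸1]+[k∸1] (3 + j))) (s≤s (s≤s (m≤n+m (suc (suc j)) j)))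

module Construction {k n : ℕ} (G : PathBlockGraph k n) (3≤k : 3 ≤ k) (u : Fin n)
  (u∈last : PathBlocks._∈ᵇ_ G u (q′ G)) (u-private : PathBlocks.Private G u) (c d : ℕ)
  (cd : (k ∸ 1 < c × d ≤ k ∸ 1) ⊎ (c ≡ k ∸ 1 × d ≡ k ∸ 1)) where

  open PathBlocks G

  Extreme : Set
  Extreme = d ≡ 0 × c ≡ 2 * k ∸ 2

  extreme? : Dec Extreme
  extreme? = (d ≟ 0) ×-dec (c ≟ 2 * k ∸ 2)

  Lifted : Fin n → Set
  Lifted x = Extreme × x ∈ᵇ q′ G

  lifted? : ∀ x → Dec (Lifted x)
  lifted? x = extreme? ×-dec (x ∈ᵇ? q′ G)

  -- Whether the joint of blocks i and i + 1 is at the bottom; this alternates along the path,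
  -- counted back from the last joint, which is at the bottom iff d > 0.
  lowJoint : ℕ → Bool
  lowJoint i = alternate (0 <ᵇ d) (q′ G ∸ suc i)

  opaque
    level : Fin n → ℕ
    level x with joint? x
    ... | yes (i , _) = if lowJoint i then 0 else 2
    ... | no  _       = if does (lifted? x) then 3 else 1

    level<4 : ∀ x → level x < 4
    level<4 x with joint? x
    ... | yes (i , _) = if-< (lowJoint i) z<s (s<s (s<s z<s))
    ... | no  _       = if-< (does (lifted? x)) ≤-refl (s<s z<s)

    level-joint : ∀ {x i} → Joint x i → level x ≡ (if lowJoint i then 0 else 2)
    level-joint {x} J with joint? x
    ... | yes (_ , J′) = cong (λ l → if lowJoint l then 0 else 2) (joint-index-unique J′ J)
    ... | no  ¬J       = contradiction (_ , J) ¬J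

    level-private : ∀ {x} → Private x → level x ≡ (if does (lifted? x) then 3 else 1)
    level-private {x} px with joint? x
    ... | yes (_ , J) = contradiction J px
    ... | no  _       = refl

  level-low : ∀ {x i} → Joint x i → lowJoint i ≡ true → level x ≡ 0
  level-low J low = trans (level-joint J) (cong (λ b → if b then 0 else 2) low)

  level-high : ∀ {x i} → Joint x i → lowJoint i ≡ false → level x ≡ 2
  level-high J high = trans (level-joint J) (cong (λ b → if b then 0 else 2) high)

  level-lifted : ∀ {x} → Private x → Lifted x → level x ≡ 3
  level-lifted {x} px lifted = trans (level-private px) (cong (λ b → if b then 3 else 1) (dec-true (lifted? x) lifted))

  level-unlifted : ∀ {x} → Private x → ¬ Lifted x → level x ≡ 1
  level-unlifted {x} px ¬lifted = trans (level-private px) (cong (λ b → if b then 3 else 1) (dec-false (lifted? x) ¬lifted))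

  0<level-private : ∀ {x} → Private x → 0 < level x
  0<level-private {x} px with lifted? x
  ... | yes lifted  = subst (0 <_) (sym (level-lifted px lifted)) z<s
  ... | no  ¬lifted = subst (0 <_) (sym (level-unlifted px ¬lifted)) z<s

  lowJoint-last : ∀ {i} → suc i ≡ q′ G → lowJoint i ≡ (0 <ᵇ d)
  lowJoint-last 1+i≡q = cong (alternate (0 <ᵇ d)) (trans (cong (q′ G ∸_) 1+i≡q) (n∸n≡0 (q′ G)))

  lowJoint-step : ∀ {i} → suc (suc i) ≤ q′ G → lowJoint (suc i) ≡ not (lowJoint i)
  lowJoint-step 2+i≤q = a≡not[b]⇒b≡not[a] (cong (alternate (0 <ᵇ d)) (m∸n≡suc[m∸[1+n]] 2+i≤q))

  lastJoint-extreme-high : ∀ {i} → suc i ≡ q′ G → Extreme → lowJoint i ≡ false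
  lastJoint-extreme-high 1+i≡q extreme = trans (lowJoint-last 1+i≡q) (cong (0 <ᵇ_) (proj₁ extreme))

  lowJoint-alternates : ∀ {x y i j} → Joint x i → Joint y j → Adj G x y → lowJoint j ≡ not (lowJoint i)
  lowJoint-alternates Jx Jy adj with joints-adjacent Jx Jy adj
  ... | inj₁ refl = lowJoint-step (≤-pred (∈ᵇ⇒< (proj₂ Jy)))
  ... | inj₂ refl = a≡not[b]⇒b≡not[a] (lowJoint-step (≤-pred (∈ᵇ⇒< (proj₂ Jx))))

  lowJoint-neighbour-level : ∀ {x y i} → Joint x i → lowJoint i ≡ true → Adj G x y → 0 < level y
  lowJoint-neighbour-level {y = y} Jx low adj with joint-or-private y
  ... | inj₁ (_ , Jy) = subst (0 <_) (sym (level-high Jy y-high)) z<s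
    where y-high = trans (lowJoint-alternates Jx Jy adj) (cong not low)
  ... | inj₂ py       = 0<level-private py

  highJoint-neighbour-level : ∀ {x y i} → Joint x i → lowJoint i ≡ false → Adj G y x →
                              (Private y → ¬ Lifted y) → level y < 2
  highJoint-neighbour-level {y = y} Jx high adj unlifted with joint-or-private y
  ... | inj₁ (_ , Jy) = subst (_< 2) (sym (level-low Jy y-low)) z<s
    where y-low = trans (lowJoint-alternates Jx Jy (Adj-sym adj)) (cong not high)
  ... | inj₂ py       = subst (_< 2) (sym (level-unlifted py (unlifted py))) (s<s z<s)

  open LexKey level using (key; key-mono; key-injective; key-bound)
  open Threshold key key-injective using (below; ∈below⁺; ∈below⁻; threshold)

  last∖u : Subset n
  last∖u = block (q′ G) - u

  ∈last∖u⁺ : ∀ {x} → x ∈ᵇ q′ G → x ≢ u → x ∈ last∖u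
  ∈last∖u⁺ x∈last x≢u = x∈p∧x≢y⇒x∈p-y (∈block x∈last) x≢u

  d≤k∸1 : d ≤ k ∸ 1
  d≤k∸1 = [ proj₂ , ≤-reflexive ∘ proj₂ ]′ cd

  1≤k : 1 ≤ k
  1≤k = ≤-trans (s≤s z≤n) 3≤k

  k∸1<k : k ∸ 1 < k
  k∸1<k = ≤-reflexive (suc[k∸1]≡k 1≤k)

  0<c : 0 < c
  0<c = [ (λ (k∸1<c , _) → ≤-<-trans z≤n k∸1<c) , (λ (c≡k∸1 , _) → subst (0 <_) (sym c≡k∸1) 0<k∸1) ]′ cd
    where 0<k∸1 = ≤-trans (s≤s z≤n) (∸-monoˡ-≤ 1 3≤k)

  threshold-for-d : ∃ λ m → ∣ last∖u ∩ below m ∣ ≡ d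
  threshold-for-d = threshold last∖u (key-bound level<4) (subst (d ≤_) (sym (∣block-x∣ u∈last)) d≤k∸1)

  module Oriented (m : ℕ) (∣last∖u∩below∣≡d : ∣ last∖u ∩ below m ∣ ≡ d) where

    open InsertAt key key-injective u m
    open RankOrientation G rank rank-injective public

    d⁻ : Fin n → ℕ
    d⁻ = indeg orientation

    joint≢u : ∀ {x i} → Joint x i → x ≢ u
    joint≢u J refl = u-private J

    u-neighbour-last : ∀ {x} → Adj G x u → x ∈ᵇ q′ G
    u-neighbour-last = private-neighbour u-private u∈last

    rank-by-level : ∀ {x y} → x ≢ u → y ≢ u → level x < level y → rank x < rank y
    rank-by-level x≢u y≢u lx<ly = rank-mono x≢u y≢u (key-mono lx<ly)

    lowLastJoint-key<m : ∀ {x i} → Joint x i → lowJoint i ≡ true → x ∈ᵇ q′ G → key x < m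
    lowLastJoint-key<m {x} J low x∈last = key<m (0<∣p∣⇒Nonempty (subst (0 <_) (sym ∣last∖u∩below∣≡d) 0<d))
      where
      0<d : 0 < d
      0<d = 0<ᵇ⇒0< (trans (sym (lowJoint-last (joint-last J x∈last))) low)
      key<m : Nonempty (last∖u ∩ below m) → key x < m
      key<m (z , z∈) with x∈p∩q⁻ last∖u (below m) z∈
      ... | z∈last∖u , z∈below with z Fin.≟ x
      ...   | yes refl = ∈below⁻ z∈below
      ...   | no  z≢x  = <-trans (key-mono lx<lz) (∈below⁻ z∈below)
        where
        pz : Private z
        pz Jz = z≢x (sym (last-joint-unique J Jz x∈last (inBlock (proj₁ (x∈p-y⁻ z∈last∖u)))))
        lx<lz : level x < level z
        lx<lz = subst (_< level z) (sym (level-low J low)) (0<level-private pz)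

    highLastJoint-m≤key : ∀ {x i} → Joint x i → lowJoint i ≡ false → x ∈ᵇ q′ G → m ≤ key x
    highLastJoint-m≤key J high x∈last = ≮⇒≥ λ key<m →
      >⇒≢ (x∈p⇒0<∣p∣ (x∈p∩q⁺ (∈last∖u⁺ x∈last (joint≢u J) , ∈below⁺ key<m))) (trans ∣last∖u∩below∣≡d d≡0)
      where d≡0 = ¬0<ᵇ⇒≡0 (trans (sym (lowJoint-last (joint-last J x∈last))) high)

    lowJoint-below : ∀ {x y i} → Joint x i → lowJoint i ≡ true → Adj G x y → rank x < rank y
    lowJoint-below {y = y} J low adj with y Fin.≟ u
    ... | yes refl = rank<rank-u (joint≢u J) (lowLastJoint-key<m J low (u-neighbour-last adj))
    ... | no  y≢u  = rank-by-level (joint≢u J) y≢u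
                       (subst (_< level y) (sym (level-low J low)) (lowJoint-neighbour-level J low adj))

    highJoint-above : ∀ {x y i} → Joint x i → lowJoint i ≡ false → Adj G y x →
                      (Private y → ¬ Lifted y) → rank y < rank x
    highJoint-above {y = y} J high adj unlifted with y Fin.≟ u
    ... | yes refl = rank-u<rank (joint≢u J) (highLastJoint-m≤key J high (u-neighbour-last (Adj-sym adj)))
    ... | no  y≢u  = rank-by-level y≢u (joint≢u J)
                       (subst (level y <_) (sym (level-high J high)) (highJoint-neighbour-level J high adj unlifted))

    d⁻-u : d⁻ u ≡ d
    d⁻-u = trans (indeg≡∣S∣ (last∖u ∩ below m) ⊇ ⊆) ∣last∖u∩below∣≡d
      where
      ⊇ : last∖u ∩ below m ⊆ inNeighbours u
      ⊇ z∈ with x∈p∩q⁻ last∖u (below m) z∈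
      ... | z∈last∖u , z∈below with x∈p-y⁻ z∈last∖u
      ...   | z∈last , z≢u =
        ∈inNeighbours⁺ (block⇒Adj z≢u (inBlock z∈last) u∈last) (rank<rank-u z≢u (∈below⁻ z∈below))
      ⊆ : inNeighbours u ⊆ last∖u ∩ below m
      ⊆ z∈ with ∈inNeighbours⁻ z∈
      ... | adj@(z≢u , _) , rz<ru = x∈p∩q⁺ (∈last∖u⁺ (u-neighbour-last adj) z≢u , ∈below⁺ (rank<rank-u⁻ z≢u rz<ru))

    d⁻-lowJoint : ∀ {x i} → Joint x i → lowJoint i ≡ true → d⁻ x ≡ 0
    d⁻-lowJoint J low = indeg-source λ adj → lowJoint-below J low (Adj-sym adj)

    inNeighbours-joint : ∀ {x i} → Joint x i → inNeighbours x ⊆ (block i - x) ∪ (block (suc i) - x)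
    inNeighbours-joint J z∈ with ∈inNeighbours⁻ z∈
    ... | adj , _ with joint-neighbour J adj
    ...   | inj₁ z∈i   = x∈p∪q⁺ (inj₁ (x∈p∧x≢y⇒x∈p-y (∈block z∈i) (proj₁ adj)))
    ...   | inj₂ z∈1+i = x∈p∪q⁺ (inj₂ (x∈p∧x≢y⇒x∈p-y (∈block z∈1+i) (proj₁ adj)))

    ∣joint-neighbourhood∣ : ∀ {x i} → Joint x i → ∣ (block i - x) ∪ (block (suc i) - x) ∣ ≡ 2 * k ∸ 2
    ∣joint-neighbourhood∣ {x} {i} J@(x∈i , x∈1+i) = begin
      ∣ (block i - x) ∪ (block (suc i) - x) ∣ ≡⟨ Empty[p∩q]⇒∣p∪q∣≡∣p∣+∣q∣ (block i - x) (block (suc i) - x) disjoint ⟩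
      ∣ block i - x ∣ + ∣ block (suc i) - x ∣ ≡⟨ cong₂ _+_ (∣block-x∣ x∈i) (∣block-x∣ x∈1+i) ⟩
      (k ∸ 1) + (k ∸ 1)                       ≡⟨ 2*k∸2≡[k∸1]+[k∸1] k ⟨
      2 * k ∸ 2                               ∎
      where
      open ≡-Reasoning
      disjoint : Empty ((block i - x) ∩ (block (suc i) - x))
      disjoint (z , z∈) with x∈p∩q⁻ (block i - x) (block (suc i) - x) z∈
      ... | z∈i-x , z∈1+i-x = proj₂ (x∈p-y⁻ z∈i-x)
                                (joint-unique (inBlock (proj₁ (x∈p-y⁻ z∈i-x)) , inBlock (proj₁ (x∈p-y⁻ z∈1+i-x))) J)

    d⁻-highJoint : ∀ {x i} → Joint x i → lowJoint i ≡ false → ¬ (suc i ≡ q′ G × Extreme) → d⁻ x ≡ 2 * k ∸ 2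
    d⁻-highJoint {x} {i} J@(x∈i , x∈1+i) high ¬lastExtreme =
      trans (indeg≡∣S∣ _ ⊇ (inNeighbours-joint J)) (∣joint-neighbourhood∣ J)
      where
      block-x⊆ : ∀ {l} → x ∈ᵇ l → block l - x ⊆ inNeighbours x
      block-x⊆ x∈l y∈ with x∈p-y⁻ y∈
      ... | y∈l , y≢x = ∈inNeighbours⁺ adj (highJoint-above J high adj unlifted)
        where
        adj = block⇒Adj y≢x (inBlock y∈l) x∈l
        unlifted : Private _ → ¬ Lifted _
        unlifted py (extreme , y∈last) =
          ¬lastExtreme (joint-last J (private-neighbour py y∈last (Adj-sym adj)) , extreme)
      ⊇ : (block i - x) ∪ (block (suc i) - x) ⊆ inNeighbours x
      ⊇ y∈ with x∈p∪q⁻ (block i - x) (block (suc i) - x) y∈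
      ... | inj₁ y∈i-x   = block-x⊆ x∈i y∈i-x
      ... | inj₂ y∈1+i-x = block-x⊆ x∈1+i y∈1+i-x

    inNeighbours-lastJoint-extreme : ∀ {x i} → Joint x i → suc i ≡ q′ G → Extreme →
                                     inNeighbours x ⊆ (block i - x) ∪ ⁅ u ⁆
    inNeighbours-lastJoint-extreme {x} J 1+i≡q extreme {y} y∈ with ∈inNeighbours⁻ y∈
    ... | adj , ry<rx with joint-neighbour J adj
    ...   | inj₁ y∈i = x∈p∪q⁺ (inj₁ (x∈p∧x≢y⇒x∈p-y (∈block y∈i) (proj₁ adj)))
    ...   | inj₂ y∈1+i with y Fin.≟ u | joint-or-private y
    ...     | yes refl | _             = x∈p∪q⁺ (inj₂ (x∈⁅x⁆ u))
    ...     | no  _    | inj₁ (_ , Jy) = contradiction (last-joint-unique Jy J y∈last x∈last) (proj₁ adj)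
      where
      y∈last = subst (y ∈ᵇ_) 1+i≡q y∈1+i
      x∈last = subst (x ∈ᵇ_) 1+i≡q (proj₂ J)
    ...     | no  y≢u  | inj₂ py       = contradiction ry<rx (<-asym (rank-by-level (joint≢u J) y≢u lx<ly))
      where
      lx<ly : level x < level y
      lx<ly = subst₂ _<_ (sym (level-high J (lastJoint-extreme-high 1+i≡q extreme)))
                         (sym (level-lifted py (extreme , subst (y ∈ᵇ_) 1+i≡q y∈1+i))) (s<s (s<s z<s))

    d⁻-lastJoint-extreme : ∀ {x i} → Joint x i → suc i ≡ q′ G → Extreme → d⁻ x ≡ k
    d⁻-lastJoint-extreme {x} {i} J@(x∈i , x∈1+i) 1+i≡q extreme = begin
      d⁻ x                        ≡⟨ indeg≡∣S∣ _ ⊇ (inNeighbours-lastJoint-extreme J 1+i≡q extreme) ⟩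
      ∣ (block i - x) ∪ ⁅ u ⁆ ∣   ≡⟨ Empty[p∩q]⇒∣p∪q∣≡∣p∣+∣q∣ (block i - x) ⁅ u ⁆ u∉block[i] ⟩
      ∣ block i - x ∣ + ∣ ⁅ u ⁆ ∣ ≡⟨ cong₂ _+_ (∣block-x∣ x∈i) (∣⁅x⁆∣≡1 u) ⟩
      (k ∸ 1) + 1                 ≡⟨ m∸n+n≡m 1≤k ⟩
      k                           ∎
      where
      open ≡-Reasoning
      high = lastJoint-extreme-high 1+i≡q extreme
      i≢q : i ≢ q′ G
      i≢q i≡q = 1+n≢n (trans 1+i≡q (sym i≡q))
      u∉block[i] : Empty ((block i - x) ∩ ⁅ u ⁆)
      u∉block[i] (z , z∈) with x∈p∩q⁻ (block i - x) ⁅ u ⁆ z∈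
      ... | z∈i-x , z∈⁅u⁆ with x∈⁅y⁆⇒x≡y u z∈⁅u⁆
      ...   | refl = i≢q (private-block-unique u-private (inBlock (proj₁ (x∈p-y⁻ z∈i-x))) u∈last)
      ⊇ : (block i - x) ∪ ⁅ u ⁆ ⊆ inNeighbours x
      ⊇ y∈ with x∈p∪q⁻ (block i - x) ⁅ u ⁆ y∈
      ... | inj₁ y∈i-x = ∈inNeighbours⁺ adj (highJoint-above J high adj unlifted)
        where
        y∈i = inBlock (proj₁ (x∈p-y⁻ y∈i-x))
        adj = block⇒Adj (proj₂ (x∈p-y⁻ y∈i-x)) y∈i x∈i
        unlifted : Private _ → ¬ Lifted _
        unlifted py (_ , y∈last) = i≢q (private-block-unique py y∈i y∈last)
      ... | inj₂ y∈⁅u⁆ with x∈⁅y⁆⇒x≡y u y∈⁅u⁆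
      ...   | refl = ∈inNeighbours⁺ (block⇒Adj (≢-sym (joint≢u J)) u∈last x∈last)
                       (rank-u<rank (joint≢u J) (highLastJoint-m≤key J high x∈last))
        where x∈last = subst (x ∈ᵇ_) 1+i≡q x∈1+i

    inNeighbours-private : ∀ {x i} → Private x → x ∈ᵇ i → inNeighbours x ⊆ block i - x
    inNeighbours-private px x∈i y∈ with ∈inNeighbours⁻ y∈
    ... | adj , _ = x∈p∧x≢y⇒x∈p-y (∈block (private-neighbour px x∈i adj)) (proj₁ adj)

    d⁻-private≤ : ∀ {x} → Private x → d⁻ x ≤ k ∸ 1
    d⁻-private≤ {x} px with block-cover x
    ... | i , x∈i = ≤-trans (indeg≤∣S∣ _ (inNeighbours-private px x∈i)) (≤-reflexive (∣block-x∣ x∈i))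

    d⁻-private-mono : ∀ {x y} → Private x → Adj G x y → rank x < rank y → d⁻ x < d⁻ y
    d⁻-private-mono px adj rx<ry with Adj⇒block adj
    ... | _ , x∈l , y∈l = indeg-mono adj rx<ry λ adj-zx z≢y → block⇒Adj z≢y (private-neighbour px x∈l adj-zx) y∈l

    d⁻-lastPrivate<k∸1 : ∀ {x} → d ≡ k ∸ 1 → Private x → x ∈ᵇ q′ G → x ≢ u → d⁻ x < k ∸ 1
    d⁻-lastPrivate<k∸1 {x} d≡k∸1 px x∈last x≢u = begin-strict
      d⁻ x                  <⟨ indeg<∣S∣ _ (inNeighbours-private px x∈last , u , u∈last-x , u∉inNeighbours) ⟩
      ∣ block (q′ G) - x ∣  ≡⟨ ∣block-x∣ x∈last ⟩
      k ∸ 1                 ∎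
      where
      open ≤-Reasoning
      key<m : key x < m
      key<m = ≰⇒> λ m≤key → <-irrefl (trans ∣last∖u∩below∣≡d (trans d≡k∸1 (sym (∣block-x∣ u∈last))))
        (p⊂q⇒∣p∣<∣q∣ (p∩q⊆p last∖u (below m) , x , ∈last∖u⁺ x∈last x≢u ,
                      λ x∈ → <⇒≱ (∈below⁻ (proj₂ (x∈p∩q⁻ last∖u (below m) x∈))) m≤key))
      u∈last-x : u ∈ block (q′ G) - x
      u∈last-x = x∈p∧x≢y⇒x∈p-y (∈block u∈last) (≢-sym x≢u)
      u∉inNeighbours : u ∉ inNeighbours x
      u∉inNeighbours u∈ = <-asym (proj₂ (∈inNeighbours⁻ u∈)) (rank<rank-u x≢u key<m)

    d⁻≤2*k∸2 : ∀ x → d⁻ x ≤ 2 * k ∸ 2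
    d⁻≤2*k∸2 x with joint-or-private x
    ... | inj₁ (_ , J) = ≤-trans (indeg≤∣S∣ _ (inNeighbours-joint J)) (≤-reflexive (∣joint-neighbourhood∣ J))
    ... | inj₂ px      = begin
      d⁻ x              ≤⟨ d⁻-private≤ px ⟩
      k ∸ 1             ≤⟨ m≤m+n (k ∸ 1) (k ∸ 1) ⟩
      (k ∸ 1) + (k ∸ 1) ≡⟨ 2*k∸2≡[k∸1]+[k∸1] k ⟨
      2 * k ∸ 2         ∎
      where open ≤-Reasoning

    k≤d⁻-highJoint : ∀ {x i} → Joint x i → lowJoint i ≡ false → k ≤ d⁻ x
    k≤d⁻-highJoint {i = i} J high with (suc i ≟ q′ G) ×-dec extreme?
    ... | yes (1+i≡q , extreme) = ≤-reflexive (sym (d⁻-lastJoint-extreme J 1+i≡q extreme))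
    ... | no  ¬lastExtreme      = subst (k ≤_) (sym (d⁻-highJoint J high ¬lastExtreme)) (<⇒≤ (k<2*k∸2 3≤k))

    d⁻-joint-distinct : ∀ {x y i} → Joint x i → Adj G x y → d⁻ x ≢ d⁻ y
    d⁻-joint-distinct {y = y} {i} J adj with lowJoint i in lowness
    ... | true = λ eq → >⇒≢ (0<indeg adj (lowJoint-below J lowness adj)) (trans (sym eq) (d⁻-lowJoint J lowness))
    ... | false with joint-or-private y
    ...   | inj₁ (_ , Jy) = λ eq → >⇒≢ (<-≤-trans 1≤k (k≤d⁻-highJoint J lowness)) (trans eq (d⁻-lowJoint Jy y-low))
      where y-low = trans (lowJoint-alternates J Jy adj) (cong not lowness)
    ...   | inj₂ py       = >⇒≢ (≤-<-trans (d⁻-private≤ py) (<-≤-trans k∸1<k (k≤d⁻-highJoint J lowness)))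

    d⁻-proper : ProperColoring G d⁻
    d⁻-proper x y adj with joint-or-private x | joint-or-private y
    ... | inj₁ (_ , Jx) | _             = d⁻-joint-distinct Jx adj
    ... | inj₂ _        | inj₁ (_ , Jy) = ≢-sym (d⁻-joint-distinct Jy (Adj-sym adj))
    ... | inj₂ px       | inj₂ py with <-cmp (rank x) (rank y)
    ...   | tri< rx<ry _ _ = <⇒≢ (d⁻-private-mono px adj rx<ry)
    ...   | tri≈ _ rx≡ry _ = contradiction (rank-injective rx≡ry) (proj₁ adj)
    ...   | tri> _ _ ry<rx = >⇒≢ (d⁻-private-mono py (Adj-sym adj) ry<rx)

    c≢d⁻-last : ∀ {y} → y ∈ᵇ q′ G → y ≢ u → c ≢ d⁻ y
    c≢d⁻-last {y} y∈last y≢u with joint-or-private y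
    ... | inj₂ py = [ (λ (k∸1<c , _) → >⇒≢ (≤-<-trans (d⁻-private≤ py) k∸1<c))
                    , (λ (c≡k∸1 , d≡k∸1) → >⇒≢ (subst (d⁻ y <_) (sym c≡k∸1) (d⁻-lastPrivate<k∸1 d≡k∸1 py y∈last y≢u)))
                    ]′ cd
    ... | inj₁ (i , J) with lowJoint i in lowness
    ...   | true = λ c≡d⁻y → >⇒≢ 0<c (trans c≡d⁻y (d⁻-lowJoint J lowness))
    ...   | false with extreme?
    ...     | yes extreme@(_ , c≡2*k∸2) = λ c≡d⁻y → >⇒≢ (k<2*k∸2 3≤k)
      (trans (sym c≡2*k∸2) (trans c≡d⁻y (d⁻-lastJoint-extreme J (joint-last J y∈last) extreme)))
    ...     | no ¬extreme = λ c≡d⁻y → ¬extreme (d≡0 , trans c≡d⁻y (d⁻-highJoint J lowness (¬extreme ∘ proj₂)))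
      where d≡0 = ¬0<ᵇ⇒≡0 (trans (sym (lowJoint-last (joint-last J y∈last))) lowness)

    compensated : CompensatedBy orientation c d u
    compensated = d⁻-u , proper
      where
      proper : ProperColoring G (compMap orientation c u)
      proper x y adj with x Fin.≟ u | y Fin.≟ u
      ... | yes refl | yes refl = λ _ → proj₁ adj refl
      ... | yes refl | no  y≢u  = c≢d⁻-last (u-neighbour-last (Adj-sym adj)) y≢u
      ... | no  x≢u  | yes refl = ≢-sym (c≢d⁻-last (u-neighbour-last adj) x≢u)
      ... | no  _    | no  _    = d⁻-proper x y adj

    bounded : IsLOrientation (c ⊔ (2 * k ∸ 2)) orientation
    bounded v = ≤-trans (d⁻≤2*k∸2 v) (m≤n⊔m c (2 * k ∸ 2))

lemma19 : (k n : ℕ) → 3 ≤ k → (G : PathBlockGraph k n) → (u : Fin n) →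
    u ∈ lastClique G → ¬ IsCutVertex G u → (c d : ℕ) →
    ((k ∸ 1 < c × d ≤ k ∸ 1) ⊎ (c ≡ k ∸ 1 × d ≡ k ∸ 1)) →
    ∃ λ (D : Orientation G) →
      IsLOrientation (c ⊔ (2 * k ∸ 2)) D × CompensatedBy D c d u
lemma19 k n 3≤k G u u∈last ¬cut c d cd = orientation , bounded , compensated
  where
  open PathBlocks G using (∈lastClique⇒∈ᵇ; nonCut⇒Private)
  open Construction G 3≤k u (∈lastClique⇒∈ᵇ u∈last) (nonCut⇒Private ¬cut) c d cd
  open Oriented (proj₁ threshold-for-d) (proj₂ threshold-for-d)
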